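{- Fix a first-order vocabulary. For every second-order sentence $\psi$ there is a sentence $\phi$ of intuitionistic dependence logic $\mathbf{ID}$ such that for every structure $M$ of the vocabulary, $M\models\psi$ if and only if $M\models_{\{\emptyset\}}\phi$.
   Context: Structures have nonempty domains. Second-order logic is standard second-order logic with standard semantics. An assignment on $M$ is a function from a finite set of variables into the domain of $M$; $s(a/x)$ is the assignment agreeing with $s$ except that it maps $x$ to $a$. A team $X$ of $M$ is a set of assignments on $M$ all with the same domain $dom(X)$. For $F:X\to M$, $X(F/x)=\{s(F(s)/x): s\in X\}$ and $X(M/x)=\{s(a/x): a\in M, s\in X\}$. Formulas of $\mathbf{ID}$ are given by: $\phi::=\alpha\mid =\!(t)\mid \bot\mid \phi\wedge\phi\mid \phi\veebar\phi\mid \phi\to\phi\mid \forall x\phi\mid\exists x\phi$, where $\alpha$ is a first-order atomic formula and $t$ a term. Team semantics, for a team $X$ whose domain contains the free variables: $M\models_X\alpha$ iff $M\models_s\alpha$ (Tarskian) for all $s\in X$; $M\models_X =\!(t)$ iff $s(t)=s'(t)$ for all $s,s'\in X$; $M\models_X\bot$ iff $X=\emptyset$; $M\models_X\phi\wedge\psi$ iff both hold; $M\models_X\phi\veebar\psi$ iff $M\models_X\phi$ or $M\models_X\psi$; $M\models_X\phi\to\psi$ iff for every $Y\subseteq X$, $M\models_Y\phi$ implies $M\models_Y\psi$; $M\models_X\exists x\phi$ iff $M\models_{X(F/x)}\phi$ for some $F:X\to M$; $M\models_X\forall x\phi$ iff $M\models_{X(M/x)}\phi$. $\{\emptyset\}$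 denotes the team consisting of the empty assignment. -}

module Defs where

open import Level using (Lift; 0ℓ) renaming (suc to lsuc)
open import Data.Nat using (ℕ; zero; suc)
open import Data.Fin using (Fin; zero; suc)
open import Data.Vec using (Vec; []; _∷_; lookup)
open import Data.List using (List; []; _∷_; length)
import Data.List as L
open import Data.Product using (Σ; _×_; _,_)
open import Data.Sum using (_⊎_)
open import Data.Empty using (⊥)
open import Data.Unit using (⊤)
open import Relation.Nullary using (¬_)
open import Relation.Binary.PropositionalEquality using (_≡_)

-- A first-order vocabulary: function symbols (constants = arity 0) and
-- relation symbols, each with an arity.  Equality is always available.
record Vocabulary : Set₁ where
  field
    FunSym : Set
    funAr  : FunSym → ℕ
    RelSym : Set
    relAr  : RelSym → ℕ

module _ (V : Vocabulary) where
  open Vocabulary V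

  -- Terms with first-order variables in Fin n (de Bruijn indices).
  data Term (n : ℕ) : Set where
    var : Fin n → Term n
    app : (f : FunSym) → Vec (Term n) (funAr f) → Term n

  data Atom (n : ℕ) : Set where
    rel : (R : RelSym) → Vec (Term n) (relAr R) → Atom n
    eq  : Term n → Term n → Atom n

  -- Structures (nonempty domain).
  record Structure : Set₁ where
    field
      Dom  : Set
      elem : Dom
      funI : (f : FunSym) → Vec Dom (funAr f) → Dom
      relI : (R : RelSym) → Vec Dom (relAr R) → Set

  data IDForm (n : ℕ) : Set where
    atom : Atom n → IDForm n
    dep  : Term n → IDForm n
    bot  : IDForm n
    _∧_  : IDForm n → IDForm n → IDForm n
    _⊻_  : IDForm n → IDForm n → IDForm n
    _⇒_  : IDForm n → IDForm n → IDForm n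
    all  : IDForm (suc n) → IDForm n
    ex   : IDForm (suc n) → IDForm n

  IDSentence : Set
  IDSentence = IDForm 0

  -- Second-order formulas: n first-order variables, Γ = list of arities
  -- of the relation variables in scope (de Bruijn).
  data SOForm (n : ℕ) (Γ : List ℕ) : Set where
    atom  : Atom n → SOForm n Γ
    rvar  : (i : Fin (length Γ)) → Vec (Term n) (L.lookup Γ i) → SOForm n Γ
    neg   : SOForm n Γ → SOForm n Γ
    _∧_   : SOForm n Γ → SOForm n Γ → SOForm n Γ
    _∨_   : SOForm n Γ → SOForm n Γ → SOForm n Γ
    all1  : SOForm (suc n) Γ → SOForm n Γ
    ex1   : SOForm (suc n) Γ → SOForm n Γ
    all2  : (k : ℕ) → SOForm n (k ∷ Γ) → SOForm n Γ
    ex2   : (k : ℕ) → SOForm n (k ∷ Γ) → SOForm n Γ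

  SOSentence : Set
  SOSentence = SOForm 0 []

  module Semantics (M : Structure) where
    open Structure M

    -- An assignment with domain {0,…,n-1} is a vector; s(a/x) for the new
    -- variable x = 0 is a ∷ s.
    Assignment : ℕ → Set
    Assignment n = Vec Dom n

    mutual
      eval : {n : ℕ} → Term n → Assignment n → Dom
      eval (var i) s = lookup s i
      eval (app f ts) s = funI f (evalVec ts s)

      evalVec : {n k : ℕ} → Vec (Term n) k → Assignment n → Vec Dom k
      evalVec [] s = []
      evalVec (t ∷ ts) s = eval t s ∷ evalVec ts s

    holds : {n : ℕ} → Atom n → Assignment n → Set
    holds (rel R ts) s = relI R (evalVec ts s)
    holds (eq t u) s = eval t s ≡ eval u s

    Team : ℕ → Set₁
    Team n = Assignment n → Set

    _⊆_ : {n : ℕ} → Team n → Team n → Set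
    Y ⊆ X = ∀ s → Y s → X s

    supplement : {n : ℕ} → Team n → (Assignment n → Dom) → Team (suc n)
    supplement X F t = Σ (Assignment _) λ s → X s × (t ≡ F s ∷ s)

    duplicate : {n : ℕ} → Team n → Team (suc n)
    duplicate X t = Σ (Assignment _) λ s → Σ Dom λ a → X s × (t ≡ a ∷ s)

    emptyAssignmentTeam : Team 0
    emptyAssignmentTeam _ = ⊤

    _⊨[_]_ : {n : ℕ} → Structure → Team n → IDForm n → Set₁
    -- (the Structure argument is always M itself; it is only notation)
    _ ⊨[ X ] atom a = Lift (lsuc 0ℓ) (∀ s → X s → holds a s)
    _ ⊨[ X ] dep t = Lift (lsuc 0ℓ) (∀ s s' → X s → X s' → eval t s ≡ eval t s')
    _ ⊨[ X ] bot = Lift (lsuc 0ℓ) (∀ s → ¬ X s)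
    _ ⊨[ X ] (φ ∧ ψ) = (M ⊨[ X ] φ) × (M ⊨[ X ] ψ)
    _ ⊨[ X ] (φ ⊻ ψ) = (M ⊨[ X ] φ) ⊎ (M ⊨[ X ] ψ)
    _ ⊨[ X ] (φ ⇒ ψ) = (Y : Team _) → Y ⊆ X → M ⊨[ Y ] φ → M ⊨[ Y ] ψ
    _ ⊨[ X ] all φ = M ⊨[ duplicate X ] φ
    _ ⊨[ X ] ex φ = Σ (Assignment _ → Dom) λ F → M ⊨[ supplement X F ] φ

    Env : List ℕ → Set₁
    Env Γ = (i : Fin (length Γ)) → Vec Dom (L.lookup Γ i) → Set

    extend : {k : ℕ} {Γ : List ℕ} → (Vec Dom k → Set) → Env Γ → Env (k ∷ Γ)
    extend R ρ zero = R
    extend R ρ (suc i) = ρ i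

    SOSat : {n : ℕ} {Γ : List ℕ} → SOForm n Γ → Env Γ → Assignment n → Set₁
    SOSat (atom a) ρ s = Lift (lsuc 0ℓ) (holds a s)
    SOSat (rvar i ts) ρ s = Lift (lsuc 0ℓ) (ρ i (evalVec ts s))
    SOSat (neg φ) ρ s = ¬ SOSat φ ρ s
    SOSat (φ ∧ ψ) ρ s = SOSat φ ρ s × SOSat ψ ρ s
    SOSat (φ ∨ ψ) ρ s = SOSat φ ρ s ⊎ SOSat ψ ρ s
    SOSat (all1 φ) ρ s = (a : Dom) → SOSat φ ρ (a ∷ s)
    SOSat (ex1 φ) ρ s = Σ Dom λ a → SOSat φ ρ (a ∷ s)
    SOSat (all2 k φ) ρ s = (R : Vec Dom k → Set) → SOSat φ (extend R ρ) s
    SOSat (ex2 k φ) ρ s = Σ (Vec Dom k → Set) λ R → SOSat φ (extend R ρ) s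

    emptyEnv : Env []
    emptyEnv ()

  _⊨SO_ : Structure → SOSentence → Set₁
  M ⊨SO ψ = Semantics.SOSat M ψ (Semantics.emptyEnv M) []

  _⊨ID_ : Structure → IDSentence → Set₁
  M ⊨ID φ = Semantics._⊨[_]_ M M (Semantics.emptyAssignmentTeam M) φ

-- Over a one-element domain a k-ary relation is either empty or full, so
-- second-order quantifiers become finite conjunctions and disjunctions over
-- truth values, and on the nonempty teams that occur the ID connectives behave
-- classically (translate₁).
--
-- Over a domain with at least two elements the translation works on teams
-- whose assignments are grouped into classes by their values on key columns;
-- each class stands for one first-order assignment, and a key column holds a
-- fixed element c. A k-ary relation R is carried by k argument columns and a
-- value column y that depends only on the keys and the arguments, R(ā) being
-- y = c; so ∀R and ∃R become ∀ over the arguments followed by ∀ or ∃ over y,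
-- guarded by that dependence (which ID expresses with →). Negation is pushed
-- to the atoms by a polarity, and ∨ becomes ∃ of a key-dependent selector
-- column that equals c on the classes satisfying the left disjunct and differs
-- from c elsewhere, which needs the second element. By induction, on good
-- teams the translation holds iff every class satisfies the formula
-- (translate-defines). Excluded middle makes the choices uniform on classes
-- and justifies the negation normal form.

module Submission where

open import Defs
open import Axiom.DoubleNegationElimination using (DoubleNegationElimination; em⇒dne)
open import Axiom.ExcludedMiddle using (ExcludedMiddle)
open import Data.Bool using (Bool; true; false; not)
open import Data.Empty using (⊥; ⊥-elim)
open import Data.Fin as Fin using (Fin; zero; suc; _↑ˡ_; _↑ʳ_)
open import Data.List using (List; []; _∷_; length)
import Data.List as List
open import Data.Nat using (ℕ; zero; suc; _+_)
open import Data.Product using (Σ; _×_; _,_; proj₁; proj₂)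
open import Data.Product.Function.NonDependent.Propositional using (_×-⇔_)
open import Data.Sum using (_⊎_; inj₁; inj₂)
open import Data.Sum.Function.Propositional using (_⊎-⇔_)
open import Data.Unit using (tt)
open import Data.Vec using (Vec; []; _∷_; lookup; tabulate; _++_; replicate; take; drop)
import Data.Vec.Functional as Vector
open import Data.Vec.Properties
  using ( lookup∘tabulate; tabulate∘lookup; tabulate-cong; lookup-++ˡ; lookup-++ʳ
        ; ∷-injective; ++-injective; take++drop≡id )
open import Function using (_∘_; _∘₂_)
open import Function.Bundles using (_⇔_; mk⇔; Equivalence)
open import Function.Construct.Identity using (⇔-id)
open import Function.Construct.Symmetry using (⇔-sym)
open import Function.Related.TypeIsomorphisms using (¬-cong-⇔)
open import Level using (Lift; 0ℓ; _⊔_; lift; lower) renaming (suc to lsuc)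
open import Relation.Binary.PropositionalEquality
open import Relation.Nullary using (¬_; Dec; yes; no)
open import Relation.Nullary.Decidable using (map′; decidable-stable)
open import Relation.Nullary.Negation using (¬∃⟶∀¬; ∀¬⟶¬∃; ∃¬⟶¬∀; _¬-⊎_)

open Equivalence using (to; from)

module Syntax (V : Vocabulary) where
  open Vocabulary V

  mutual
    rename : ∀ {n m} → (Fin n → Fin m) → Term V n → Term V m
    rename f (var i) = var (f i)
    rename f (app g ts) = app g (renameAll f ts)

    renameAll : ∀ {n m k} → (Fin n → Fin m) → Vec (Term V n) k → Vec (Term V m) k
    renameAll f [] = []
    renameAll f (t ∷ ts) = rename f t ∷ renameAll f ts

  renameAtom : ∀ {n m} → (Fin n → Fin m) → Atom V n → Atom V m
  renameAtom f (rel R ts) = rel R (renameAll f ts)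
  renameAtom f (eq t u) = eq (rename f t) (rename f u)

  ⊤ᴵ : ∀ {m} → IDForm V m
  ⊤ᴵ = bot ⇒ bot

  infix 30 ¬ᴵ_
  infix 40 _≐_

  ¬ᴵ_ : ∀ {m} → IDForm V m → IDForm V m
  ¬ᴵ φ = φ ⇒ bot

  ⋀ᴵ : ∀ {m} K → (Fin K → IDForm V m) → IDForm V m
  ⋀ᴵ zero φ = ⊤ᴵ
  ⋀ᴵ (suc K) φ = φ zero ∧ ⋀ᴵ K (Vector.tail φ)

  _≐_ : ∀ {m} → Fin m → Fin m → IDForm V m
  p ≐ q = atom (eq (var p) (var q))

  -- ID has only constancy atoms; the dependence atom =(x̄, ȳ; z) is expressed
  -- by requiring z to be constant on every subteam on which x̄, ȳ are.
  dependence : ∀ {m K k} → (Fin K → Fin m) → (Fin k → Fin m) → Fin m → IDForm V m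
  dependence {K = K} {k} xs ys z =
    (⋀ᴵ K (λ j → dep (var (xs j))) ∧ ⋀ᴵ k (λ j → dep (var (ys j)))) ⇒ dep (var z)

  ∀ᴺ : ∀ {m} k → IDForm V (k + m) → IDForm V m
  ∀ᴺ zero φ = φ
  ∀ᴺ (suc k) φ = ∀ᴺ k (all φ)

  -- A team with m columns encodes, for each class of assignments agreeing on
  -- the key columns, a first-order assignment (variable i sits in the key
  -- column varKey i) and an interpretation of the relation variables: the
  -- i-th relation holds of ā iff the assignments of the class carrying ā in the
  -- columns argCol i have equal entries in valCol i and in the key column
  -- constKey.
  record Layout (n : ℕ) (Γ : List ℕ) (m : ℕ) : Set where
    field
      #keys    : ℕ
      key      : Fin #keys → Fin m
      varKey   : Fin n → Fin #keys
      constKey : Fin #keys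
      argCol   : (i : Fin (length Γ)) → Fin (List.lookup Γ i) → Fin m
      valCol   : Fin (length Γ) → Fin m

  open Layout public

  varCol : ∀ {n Γ m} → Layout n Γ m → Fin n → Fin m
  varCol L = key L ∘ varKey L

  constCol : ∀ {n Γ m} → Layout n Γ m → Fin m
  constCol L = key L (constKey L)

  addKey : ∀ {n n' Γ m} (L : Layout n Γ m) → (Fin n' → Fin (suc (#keys L))) → Layout n' Γ (suc m)
  addKey L varKey' = record
    { #keys = suc (#keys L) ; key = Fin.lift 1 (key L) ; varKey = varKey' ; constKey = suc (constKey L)
    ; argCol = λ i j → suc (argCol L i j) ; valCol = suc ∘ valCol L }

  addVar : ∀ {n Γ m} → Layout n Γ m → Layout (suc n) Γ (suc m)
  addVar L = addKey L (Fin.lift 1 (varKey L))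

  addSelector : ∀ {n Γ m} → Layout n Γ m → Layout n Γ (suc m)
  addSelector L = addKey L (suc ∘ varKey L)

  addRel : ∀ {n Γ m} k → Layout n Γ m → Layout n (k ∷ Γ) (suc (k + m))
  addRel {m = m} k L = record
    { #keys = #keys L ; key = suc ∘ (k ↑ʳ_) ∘ key L ; varKey = varKey L ; constKey = constKey L
    ; argCol = λ { zero j → suc (j ↑ˡ m) ; (suc i) j → suc (k ↑ʳ argCol L i j) }
    ; valCol = λ { zero → zero ; (suc i) → suc (k ↑ʳ valCol L i) } }

  dependsOnKeys : ∀ {n Γ m} → Layout n Γ m → IDForm V (suc m)
  dependsOnKeys L = dependence {k = 0} (suc ∘ key L) (λ ()) zero

  dependsOnKeysAndArgs : ∀ {n Γ m} k → Layout n Γ m → IDForm V (suc (k + m))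
  dependsOnKeysAndArgs {m = m} k L = dependence (suc ∘ (k ↑ʳ_) ∘ key L) (suc ∘ (_↑ˡ m)) zero

  keyedOr : ∀ {n Γ m} → Layout n Γ m → IDForm V (suc m) → IDForm V (suc m) → IDForm V m
  keyedOr L A B =
    ex (dependsOnKeys L ∧ (((zero ≐ suc (constCol L)) ⇒ A) ∧ (¬ᴵ (zero ≐ suc (constCol L)) ⇒ B)))

  keyedEx : ∀ {n Γ m} → Layout n Γ m → IDForm V (suc m) → IDForm V m
  keyedEx L A = ex (dependsOnKeys L ∧ A)

  relAll : ∀ {n Γ m} k → Layout n Γ m → IDForm V (suc (k + m)) → IDForm V m
  relAll k L A = ∀ᴺ k (all (dependsOnKeysAndArgs k L ⇒ A))

  relEx : ∀ {n Γ m} k → Layout n Γ m → IDForm V (suc (k + m)) → IDForm V m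
  relEx k L A = ∀ᴺ k (ex (dependsOnKeysAndArgs k L ∧ A))

  argsMatch : ∀ {n Γ m} → Layout n Γ m → (i : Fin (length Γ)) → Vec (Term V n) (List.lookup Γ i) → IDForm V m
  argsMatch L i ts = ⋀ᴵ _ (λ j → atom (eq (var (argCol L i j)) (rename (varCol L) (lookup ts j))))

  -- The Boolean is the polarity: translate false φ L expresses ¬ φ.
  translate : ∀ {n Γ m} → Bool → SOForm V n Γ → Layout n Γ m → IDForm V m
  translate true (atom a) L = atom (renameAtom (varCol L) a)
  translate false (atom a) L = ¬ᴵ atom (renameAtom (varCol L) a)
  translate true (rvar i ts) L = argsMatch L i ts ⇒ (valCol L i ≐ constCol L)
  translate false (rvar i ts) L = argsMatch L i ts ⇒ ¬ᴵ (valCol L i ≐ constCol L)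
  translate b (neg φ) L = translate (not b) φ L
  translate true (φ ∧ ψ) L = translate true φ L ∧ translate true ψ L
  translate false (φ ∧ ψ) L = keyedOr L (translate false φ (addSelector L)) (translate false ψ (addSelector L))
  translate true (φ ∨ ψ) L = keyedOr L (translate true φ (addSelector L)) (translate true ψ (addSelector L))
  translate false (φ ∨ ψ) L = translate false φ L ∧ translate false ψ L
  translate true (all1 φ) L = all (translate true φ (addVar L))
  translate false (all1 φ) L = keyedEx L (translate false φ (addVar L))
  translate true (ex1 φ) L = keyedEx L (translate true φ (addVar L))
  translate false (ex1 φ) L = all (translate false φ (addVar L))
  translate true (all2 k φ) L = relAll k L (translate true φ (addRel k L))
  translate false (all2 k φ) L = relEx k L (translate false φ (addRel k L))
  translate true (ex2 k φ) L = relEx k L (translate true φ (addRel k L))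
  translate false (ex2 k φ) L = relAll k L (translate false φ (addRel k L))

  truthValue : ∀ {m} → Bool → IDForm V m
  truthValue true = ⊤ᴵ
  truthValue false = bot

  translate₁ : ∀ {n Γ} → (Fin (length Γ) → Bool) → SOForm V n Γ → IDForm V n
  translate₁ β (atom a) = atom a
  translate₁ β (rvar i ts) = truthValue (β i)
  translate₁ β (neg φ) = ¬ᴵ translate₁ β φ
  translate₁ β (φ ∧ ψ) = translate₁ β φ ∧ translate₁ β ψ
  translate₁ β (φ ∨ ψ) = translate₁ β φ ⊻ translate₁ β ψ
  translate₁ β (all1 φ) = all (translate₁ β φ)
  translate₁ β (ex1 φ) = ex (translate₁ β φ)
  translate₁ β (all2 k φ) = translate₁ (true Vector.∷ β) φ ∧ translate₁ (false Vector.∷ β) φ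
  translate₁ β (ex2 k φ) = translate₁ (true Vector.∷ β) φ ⊻ translate₁ (false Vector.∷ β) φ

  atMostOneElement : IDSentence V
  atMostOneElement = all (all (zero ≐ suc zero))

  constantLayout : Layout 0 [] 1
  constantLayout = record
    { #keys = 1 ; key = λ _ → zero ; varKey = λ () ; constKey = zero ; argCol = λ () ; valCol = λ () }

  translation : SOSentence V → IDSentence V
  translation ψ = (atMostOneElement ∧ translate₁ (λ ()) ψ)
                ⊻ (¬ᴵ atMostOneElement ∧ ex (translate true ψ constantLayout))

module TeamSemantics (V : Vocabulary) (M : Structure V) where
  open Structure M
  open Semantics V M
  open Syntax V

  infix 5 _⊨_

  _⊨_ : ∀ {n} → Team n → IDForm V n → Set₁
  X ⊨ φ = M ⊨[ X ] φ

  ⊨-downward : ∀ {n} (φ : IDForm V n) {X Y : Team n} → X ⊆ Y → Y ⊨ φ → X ⊨ φ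
  ⊨-downward (atom a) X⊆Y (lift h) = lift (λ s xs → h s (X⊆Y s xs))
  ⊨-downward (dep t) X⊆Y (lift h) = lift (λ s s' xs xs' → h s s' (X⊆Y s xs) (X⊆Y s' xs'))
  ⊨-downward bot X⊆Y (lift h) = lift (λ s xs → h s (X⊆Y s xs))
  ⊨-downward (φ ∧ ψ) X⊆Y (a , b) = ⊨-downward φ X⊆Y a , ⊨-downward ψ X⊆Y b
  ⊨-downward (φ ⊻ ψ) X⊆Y (inj₁ a) = inj₁ (⊨-downward φ X⊆Y a)
  ⊨-downward (φ ⊻ ψ) X⊆Y (inj₂ b) = inj₂ (⊨-downward ψ X⊆Y b)
  ⊨-downward (φ ⇒ ψ) X⊆Y h Z Z⊆X = h Z (λ s zs → X⊆Y s (Z⊆X s zs))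
  ⊨-downward (all φ) X⊆Y h = ⊨-downward φ (λ { t (s , a , xs , e) → s , a , X⊆Y s xs , e }) h
  ⊨-downward (ex φ) X⊆Y (F , h) = F , ⊨-downward φ (λ { t (s , xs , e) → s , X⊆Y s xs , e }) h

  ⊨⊤ᴵ : ∀ {n} {X : Team n} → X ⊨ ⊤ᴵ
  ⊨⊤ᴵ Y Y⊆X h = h

  ⋀ᴵ-⊨ : ∀ {n} K (φ : Fin K → IDForm V n) X → X ⊨ ⋀ᴵ K φ ⇔ (∀ j → X ⊨ φ j)
  ⋀ᴵ-⊨ zero φ X = mk⇔ (λ _ ()) (λ _ → ⊨⊤ᴵ)
  ⋀ᴵ-⊨ (suc K) φ X = mk⇔
    (λ { (h₀ , hs) → λ { zero → h₀ ; (suc j) → to (⋀ᴵ-⊨ K (Vector.tail φ) X) hs j } })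
    (λ h → h zero , from (⋀ᴵ-⊨ K (Vector.tail φ) X) (h ∘ suc))

  Flat : ∀ {n} → IDForm V n → (Assignment n → Set) → Set₁
  Flat φ P = ∀ X → X ⊨ φ ⇔ (∀ s → X s → P s)

  atom-flat : ∀ {n} (a : Atom V n) → Flat (atom a) (holds a)
  atom-flat a X = mk⇔ lower lift

  bot-flat : ∀ {n} → Flat {n} bot (λ _ → ⊥)
  bot-flat X = mk⇔ lower lift

  ⇒-flat : ∀ {n} {A B : IDForm V n} {P Q} → Flat A P → Flat B Q → Flat (A ⇒ B) (λ s → P s → Q s)
  ⇒-flat {A = A} {B} {P} {Q} flatA flatB X = mk⇔ pointwise
    (λ h Y Y⊆X hA → from (flatB Y) (λ s ys → h s (Y⊆X s ys) (to (flatA Y) hA s ys)))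
    where
    pointwise : X ⊨ A ⇒ B → ∀ s → X s → P s → Q s
    pointwise h s xs ps =
      to (flatB (_≡ s)) (h (_≡ s) (λ { _ refl → xs }) (from (flatA (_≡ s)) λ { _ refl → ps })) s refl

  ¬ᴵ-flat : ∀ {n} {A : IDForm V n} {P} → Flat A P → Flat (¬ᴵ A) (λ s → ¬ P s)
  ¬ᴵ-flat {A = A} flatA = ⇒-flat {A = A} {B = bot} flatA bot-flat

  ⋀ᴵ-flat : ∀ {n} K {φ : Fin K → IDForm V n} {P : Fin K → Assignment n → Set} →
            (∀ j → Flat (φ j) (P j)) → Flat (⋀ᴵ K φ) (λ s → ∀ j → P j s)
  ⋀ᴵ-flat K {φ} flat X = mk⇔
    (λ h s xs j → to (flat j X) (to (⋀ᴵ-⊨ K φ X) h j) s xs)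
    (λ h → from (⋀ᴵ-⊨ K φ X) (λ j → from (flat j X) (λ s xs → h s xs j)))

  Flat-cong : ∀ {n} {φ : IDForm V n} {P Q : Assignment n → Set} → (∀ s → P s ⇔ Q s) → Flat φ P → Flat φ Q
  Flat-cong P⇔Q flat X = mk⇔
    (λ h s xs → to (P⇔Q s) (to (flat X) h s xs)) (λ h → from (flat X) λ s xs → from (P⇔Q s) (h s xs))

  AgreeOn : ∀ {n K} → (Fin K → Fin n) → Assignment n → Assignment n → Set
  AgreeOn cols s s' = ∀ j → lookup s (cols j) ≡ lookup s' (cols j)

  ⋀ᴵ-constant-⊨ : ∀ {n K} (cols : Fin K → Fin n) X →
                 X ⊨ ⋀ᴵ K (λ j → dep (var (cols j))) ⇔ (∀ s s' → X s → X s' → AgreeOn cols s s')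
  ⋀ᴵ-constant-⊨ {K = K} cols X = mk⇔
    (λ h s s' xs xs' j → lower (to (⋀ᴵ-⊨ K _ X) h j) s s' xs xs')
    (λ h → from (⋀ᴵ-⊨ K _ X) (λ j → lift (λ s s' xs xs' → h s s' xs xs' j)))

  Pair : ∀ {n} → Assignment n → Assignment n → Team n
  Pair s s' t = t ≡ s ⊎ t ≡ s'

  Pair-⊆ : ∀ {n} {X : Team n} {s s'} → X s → X s' → Pair s s' ⊆ X
  Pair-⊆ xs xs' _ (inj₁ refl) = xs
  Pair-⊆ xs xs' _ (inj₂ refl) = xs'

  agreeOn-pair : ∀ {n K} {cols : Fin K → Fin n} {s s'} → AgreeOn cols s s' →
                 ∀ t t' → Pair s s' t → Pair s s' t' → AgreeOn cols t t'
  agreeOn-pair agree _ _ (inj₁ refl) (inj₁ refl) j = refl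
  agreeOn-pair agree _ _ (inj₁ refl) (inj₂ refl) j = agree j
  agreeOn-pair agree _ _ (inj₂ refl) (inj₁ refl) j = sym (agree j)
  agreeOn-pair agree _ _ (inj₂ refl) (inj₂ refl) j = refl

  dependence-⊨ : ∀ {n K k} (xs : Fin K → Fin n) (ys : Fin k → Fin n) z X →
    X ⊨ dependence xs ys z ⇔
    (∀ s s' → X s → X s' → AgreeOn xs s s' → AgreeOn ys s s' → lookup s z ≡ lookup s' z)
  dependence-⊨ xs ys z X = mk⇔
    (λ h s s' Xs Xs' agreeXs agreeYs →
      lower (h (Pair s s') (Pair-⊆ Xs Xs')
                (from (⋀ᴵ-constant-⊨ xs _) (agreeOn-pair agreeXs) , from (⋀ᴵ-constant-⊨ ys _) (agreeOn-pair agreeYs)))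
            s s' (inj₁ refl) (inj₂ refl))
    (λ h Y Y⊆X (hxs , hys) → lift (λ t t' yt yt' →
      h t t' (Y⊆X t yt) (Y⊆X t' yt')
        (to (⋀ᴵ-constant-⊨ xs Y) hxs t t' yt yt') (to (⋀ᴵ-constant-⊨ ys Y) hys t t' yt yt')))

  duplicateᴺ : ∀ {m} k → Team m → Team (k + m)
  duplicateᴺ k X t = Σ (Vec Dom k) λ v → Σ (Assignment _) λ s → X s × t ≡ v ++ s

  ∀ᴺ-⊨ : ∀ {m} k (φ : IDForm V (k + m)) X → X ⊨ ∀ᴺ k φ ⇔ duplicateᴺ k X ⊨ φ
  ∀ᴺ-⊨ zero φ X = mk⇔
    (⊨-downward φ (λ { t ([] , s , xs , refl) → xs }))
    (⊨-downward φ (λ t xt → [] , t , xt , refl))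
  ∀ᴺ-⊨ (suc k) φ X = mk⇔
    (λ h → ⊨-downward φ (λ { t ((a ∷ v) , s , xs , refl) → (v ++ s) , a , (v , s , xs , refl) , refl })
                         (to (∀ᴺ-⊨ k (all φ) X) h))
    (λ h → from (∀ᴺ-⊨ k (all φ) X)
             (⊨-downward φ (λ { t (_ , a , (v , s , xs , refl) , refl) → (a ∷ v) , s , xs , refl }) h))

  mutual
    eval-rename : ∀ {n m} (f : Fin n → Fin m) (t : Term V n) (s : Assignment m) →
                  eval (rename f t) s ≡ eval t (tabulate (lookup s ∘ f))
    eval-rename f (var i) s = sym (lookup∘tabulate (lookup s ∘ f) i)
    eval-rename f (app g ts) s = cong (funI g) (evalVec-rename f ts s)

    evalVec-rename : ∀ {n m k} (f : Fin n → Fin m) (ts : Vec (Term V n) k) (s : Assignment m) →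
                     evalVec (renameAll f ts) s ≡ evalVec ts (tabulate (lookup s ∘ f))
    evalVec-rename f [] s = refl
    evalVec-rename f (t ∷ ts) s = cong₂ _∷_ (eval-rename f t s) (evalVec-rename f ts s)

  holds-rename : ∀ {n m} (f : Fin n → Fin m) (a : Atom V n) (s : Assignment m) →
                 holds (renameAtom f a) s ⇔ holds a (tabulate (lookup s ∘ f))
  holds-rename f (rel R ts) s = mk⇔ (subst (relI R) (evalVec-rename f ts s)) (subst (relI R) (sym (evalVec-rename f ts s)))
  holds-rename f (eq t u) s = mk⇔
    (λ e → trans (sym (eval-rename f t s)) (trans e (eval-rename f u s)))
    (λ e → trans (eval-rename f t s) (trans e (sym (eval-rename f u s))))

  lookup-evalVec : ∀ {n k} (ts : Vec (Term V n) k) (s : Assignment n) j →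
                   lookup (evalVec ts s) j ≡ eval (lookup ts j) s
  lookup-evalVec (t ∷ ts) s zero = refl
  lookup-evalVec (t ∷ ts) s (suc j) = lookup-evalVec ts s j

module SecondOrder (V : Vocabulary) (M : Structure V) where
  open Structure M
  open Semantics V M

  record EnvEquiv (Γ : List ℕ) (ρ ρ' : Env Γ) : Set where
    constructor mk≋
    field ≋-at : ∀ i v → ρ i v ⇔ ρ' i v

  open EnvEquiv public

  syntax EnvEquiv Γ ρ ρ' = ρ ≋[ Γ ] ρ'

  ≋-refl : ∀ {Γ} {ρ : Env Γ} → ρ ≋[ Γ ] ρ
  ≋-refl = mk≋ λ i v → ⇔-id _

  ≋-sym : ∀ {Γ} {ρ ρ' : Env Γ} → ρ ≋[ Γ ] ρ' → ρ' ≋[ Γ ] ρ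
  ≋-sym (mk≋ e) = mk≋ λ i v → ⇔-sym (e i v)

  extend-cong : ∀ {k Γ} {ρ ρ' : Env Γ} {R R' : Vec Dom k → Set} →
                (∀ v → R v ⇔ R' v) → ρ ≋[ Γ ] ρ' → extend {Γ = Γ} R ρ ≋[ k ∷ Γ ] extend {Γ = Γ} R' ρ'
  extend-cong R⇔R' (mk≋ e) = mk≋ λ { zero → R⇔R' ; (suc i) → e i }

  SOSat-cong : ∀ {n Γ} (φ : SOForm V n Γ) {ρ ρ' : Env Γ} → ρ ≋[ Γ ] ρ' →
               ∀ s → SOSat φ ρ s ⇔ SOSat φ ρ' s
  SOSat-cong (atom a) e s = ⇔-id _
  SOSat-cong (rvar i ts) e s =
    mk⇔ (λ (lift h) → lift (to (≋-at e i _) h)) (λ (lift h) → lift (from (≋-at e i _) h))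
  SOSat-cong (neg φ) e s = ¬-cong-⇔ (SOSat-cong φ e s)
  SOSat-cong (φ ∧ ψ) e s = SOSat-cong φ e s ×-⇔ SOSat-cong ψ e s
  SOSat-cong (φ ∨ ψ) e s = SOSat-cong φ e s ⊎-⇔ SOSat-cong ψ e s
  SOSat-cong (all1 φ) e s =
    mk⇔ (λ h a → to (SOSat-cong φ e (a ∷ s)) (h a)) (λ h a → from (SOSat-cong φ e (a ∷ s)) (h a))
  SOSat-cong (ex1 φ) e s =
    mk⇔ (λ (a , h) → a , to (SOSat-cong φ e (a ∷ s)) h) (λ (a , h) → a , from (SOSat-cong φ e (a ∷ s)) h)
  SOSat-cong {Γ = Γ} (all2 k φ) e s =
    mk⇔ (λ h R → to (SOSat-cong φ (extend-cong {Γ = Γ} (λ _ → ⇔-id _) e) s) (h R))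
        (λ h R → from (SOSat-cong φ (extend-cong {Γ = Γ} (λ _ → ⇔-id _) e) s) (h R))
  SOSat-cong {Γ = Γ} (ex2 k φ) e s =
    mk⇔ (λ (R , h) → R , to (SOSat-cong φ (extend-cong {Γ = Γ} (λ _ → ⇔-id _) e) s) h)
        (λ (R , h) → R , from (SOSat-cong φ (extend-cong {Γ = Γ} (λ _ → ⇔-id _) e) s) h)

  SOSatᵇ : ∀ {n Γ} → Bool → SOForm V n Γ → Env Γ → Assignment n → Set₁
  SOSatᵇ true φ ρ s = SOSat φ ρ s
  SOSatᵇ false φ ρ s = ¬ SOSat φ ρ s

  EnvInvariant : ∀ {n Γ} → (Env Γ → Assignment n → Set₁) → Set₁
  EnvInvariant {Γ = Γ} P = ∀ {ρ ρ' : Env Γ} → ρ ≋[ Γ ] ρ' → ∀ s → P ρ s → P ρ' s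

  SOSatᵇ-invariant : ∀ {n Γ} b (φ : SOForm V n Γ) → EnvInvariant {Γ = Γ} (SOSatᵇ b φ)
  SOSatᵇ-invariant true φ e s = to (SOSat-cong φ e s)
  SOSatᵇ-invariant false φ e s h = h ∘ from (SOSat-cong φ e s)

take-drop-++ : ∀ {A : Set} {k m} (v : Vec A k) (r : Vec A m) → take k (v ++ r) ≡ v × drop k (v ++ r) ≡ r
take-drop-++ {k = k} v r = ++-injective (take k (v ++ r)) v (take++drop≡id k (v ++ r))

¬⊎-⇔ : ∀ {a b} {P : Set a} {Q : Set b} → (¬ (P ⊎ Q)) ⇔ (¬ P × ¬ Q)
¬⊎-⇔ = mk⇔ (λ ¬p⊎q → ¬p⊎q ∘ inj₁ , ¬p⊎q ∘ inj₂) (λ (¬p , ¬q) → ¬p ¬-⊎ ¬q)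

¬Σ-⇔ : ∀ {a b} {A : Set a} {P : A → Set b} → (¬ Σ A P) ⇔ (∀ x → ¬ P x)
¬Σ-⇔ = mk⇔ ¬∃⟶∀¬ ∀¬⟶¬∃

¬Π-⇔ : ∀ {a b} {A : Set a} {P : A → Set b} → DoubleNegationElimination (a ⊔ b) →
       (¬ (∀ x → P x)) ⇔ Σ A (¬_ ∘ P)
¬Π-⇔ {a} {b} {P = P} dne = mk⇔
  (λ ¬∀ → dne λ ¬∃ → ¬∀ λ x → lower (dne {Lift (a ⊔ b) (P x)} λ ¬px → ¬∃ (x , ¬px ∘ lift)))
  ∃¬⟶¬∀

module Classical (em : ExcludedMiddle (lsuc 0ℓ)) where
  decide : (P : Set) → Dec P
  decide P = map′ lower lift em

  dne : DoubleNegationElimination (lsuc 0ℓ)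
  dne = em⇒dne em

  ¬¬-⇔ : {P : Set₁} → (¬ ¬ P) ⇔ P
  ¬¬-⇔ = mk⇔ dne (λ p ¬p → ¬p p)

  ¬×-⇔ : {P Q : Set₁} → (¬ (P × Q)) ⇔ (¬ P ⊎ ¬ Q)
  ¬×-⇔ {P} = mk⇔ (case (em {P})) (λ { (inj₁ ¬p) (p , _) → ¬p p ; (inj₂ ¬q) (_ , q) → ¬q q })
    where
    case : ∀ {Q} → Dec P → ¬ (P × Q) → ¬ P ⊎ ¬ Q
    case (yes p) ¬pq = inj₂ λ q → ¬pq (p , q)
    case (no ¬p) _ = inj₁ ¬p

module Encoding (V : Vocabulary) (M : Structure V) (em : ExcludedMiddle (lsuc 0ℓ)) where
  open Structure M
  open Semantics V M
  open Syntax V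
  open TeamSemantics V M
  open SecondOrder V M
  open Classical em

  ReadsAt : ∀ {m k} → Assignment m → (Fin k → Fin m) → Vec Dom k → Set
  ReadsAt r cols v = ∀ j → lookup r (cols j) ≡ lookup v j

  record SameKeys {n Γ m} (L : Layout n Γ m) (r r' : Assignment m) : Set where
    constructor sameKeys
    field agreeOnKeys : AgreeOn (key L) r r'

  open SameKeys

  module _ {n Γ m} {L : Layout n Γ m} where
    sameKeys-refl : ∀ {r} → SameKeys L r r
    sameKeys-refl = sameKeys λ _ → refl

    sameKeys-sym : ∀ {r r'} → SameKeys L r r' → SameKeys L r' r
    sameKeys-sym (sameKeys e) = sameKeys (sym ∘ e)

    sameKeys-trans : ∀ {r r' r''} → SameKeys L r r' → SameKeys L r' r'' → SameKeys L r r''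
    sameKeys-trans (sameKeys e) (sameKeys e') = sameKeys λ j → trans (e j) (e' j)

  assignmentOf : ∀ {n Γ m} → Layout n Γ m → Assignment m → Assignment n
  assignmentOf L r = tabulate (lookup r ∘ varCol L)

  constOf : ∀ {n Γ m} → Layout n Γ m → Assignment m → Dom
  constOf L r = lookup r (constCol L)

  envOf : ∀ {n Γ m} → Layout n Γ m → Team m → Assignment m → Env Γ
  envOf L X r i ā =
    ∀ r' → X r' → SameKeys L r r' → ReadsAt r' (argCol L i) ā → lookup r' (valCol L i) ≡ constOf L r'

  record Good {n Γ m} (L : Layout n Γ m) (X : Team m) : Set where
    field
      total : ∀ r → X r → ∀ i (ā : Vec Dom (List.lookup Γ i)) →
              Σ (Assignment m) λ r' → X r' × SameKeys L r r' × ReadsAt r' (argCol L i) ā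
      functional : ∀ r r' → X r → X r' → SameKeys L r r' →
                   ∀ i → AgreeOn (argCol L i) r r' → lookup r (valCol L i) ≡ lookup r' (valCol L i)

  open Good public

  module _ {n Γ m} (L : Layout n Γ m) {r r' : Assignment m} (same : SameKeys L r r') where
    assignmentOf-cong : assignmentOf L r ≡ assignmentOf L r'
    assignmentOf-cong = tabulate-cong (agreeOnKeys same ∘ varKey L)

    constOf-cong : constOf L r ≡ constOf L r'
    constOf-cong = agreeOnKeys same (constKey L)

    envOf-cong : ∀ X → envOf L X r ≋[ Γ ] envOf L X r'
    envOf-cong X = mk≋ λ i ā → mk⇔
      (λ h r'' x s → h r'' x (sameKeys-trans same s))
      (λ h r'' x s → h r'' x (sameKeys-trans (sameKeys-sym same) s))

  keysOf : ∀ {n Γ m} (L : Layout n Γ m) → Assignment m → Vec Dom (#keys L)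
  keysOf L r = tabulate (lookup r ∘ key L)

  keysOf-injective : ∀ {n Γ m} (L : Layout n Γ m) {r r'} → keysOf L r ≡ keysOf L r' → SameKeys L r r'
  keysOf-injective L {r} {r'} e = sameKeys λ j → begin
    lookup r (key L j)              ≡⟨ lookup∘tabulate (lookup r ∘ key L) j ⟨
    lookup (keysOf L r) j           ≡⟨ cong (λ κ → lookup κ j) e ⟩
    lookup (keysOf L r') j          ≡⟨ lookup∘tabulate (lookup r' ∘ key L) j ⟩
    lookup r' (key L j)             ∎
    where open ≡-Reasoning

  -- The choice of F r is made once per class of assignments with equal keys,
  -- through a representative found by excluded middle; the default a₀ is used
  -- on classes not meeting X.
  choiceOnKeys : ∀ {n Γ m} (L : Layout n Γ m) (X : Team m) {A : Set} (a₀ : A) (P : Assignment m → A → Set₁) →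
    (∀ r r' a → SameKeys L r r' → P r' a → P r a) → (∀ r → X r → Σ A (P r)) →
    Σ (Assignment m → A) λ F → (∀ r r' → SameKeys L r r' → F r ≡ F r') × (∀ r → X r → P r (F r))
  choiceOnKeys {m = m} L X {A} a₀ P transport exists = F , F-respects , F-chooses
    where
    Represented : Vec Dom (#keys L) → Set
    Represented κ = Σ (Assignment m) λ r → X r × keysOf L r ≡ κ
    pick : ∀ {κ} → Dec (Represented κ) → A
    pick (yes (r , xr , _)) = proj₁ (exists r xr)
    pick (no _) = a₀
    F : Assignment m → A
    F r = pick (decide (Represented (keysOf L r)))
    F-respects : ∀ r r' → SameKeys L r r' → F r ≡ F r'
    F-respects r r' same = cong (λ κ → pick (decide (Represented κ))) (tabulate-cong (agreeOnKeys same))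
    F-chooses : ∀ r → X r → P r (F r)
    F-chooses r xr = chosen (decide (Represented (keysOf L r)))
      where
      chosen : (d : Dec (Represented (keysOf L r))) → P r (pick d)
      chosen (yes (r' , xr' , e)) = transport r r' _ (keysOf-injective L (sym e)) (proj₂ (exists r' xr'))
      chosen (no ¬rep) = ⊥-elim (¬rep (r , xr , refl))

  record Defines {n Γ m} (L : Layout n Γ m) (A : IDForm V m) (P : Env Γ → Assignment n → Set₁) : Set₁ where
    field at : ∀ (X : Team m) → Good L X → X ⊨ A ⇔ (∀ r → X r → P (envOf L X r) (assignmentOf L r))

  open Defines public

  Defines-cong : ∀ {n Γ m} {L : Layout n Γ m} {A} {P Q : Env Γ → Assignment n → Set₁} →
                 (∀ ρ s → P ρ s ⇔ Q ρ s) → Defines L A P → Defines L A Q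
  Defines-cong P⇔Q defines .at X good = mk⇔
    (λ h r xr → to (P⇔Q _ _) (to (defines .at X good) h r xr))
    (λ h → from (defines .at X good) (λ r xr → from (P⇔Q _ _) (h r xr)))

  ∧-defines : ∀ {n Γ m} {L : Layout n Γ m} {A B} {P Q : Env Γ → Assignment n → Set₁} →
              Defines L A P → Defines L B Q → Defines L (A ∧ B) (λ ρ s → P ρ s × Q ρ s)
  ∧-defines definesA definesB .at X good = mk⇔
    (λ (hA , hB) r xr → to (definesA .at X good) hA r xr , to (definesB .at X good) hB r xr)
    (λ h → from (definesA .at X good) (proj₁ ∘₂ h) , from (definesB .at X good) (proj₂ ∘₂ h))

  flat-defines : ∀ {n Γ m} {L : Layout n Γ m} {A} {P : Assignment m → Set} {Q : Assignment n → Set₁} →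
                 Flat A P → (∀ r → P r ⇔ Q (assignmentOf L r)) → Defines L A (λ _ → Q)
  flat-defines flat P⇔Q .at X good = mk⇔
    (λ h r xr → to (P⇔Q r) (to (flat X) h r xr)) (λ h → from (flat X) λ r xr → from (P⇔Q r) (h r xr))

  record KeyExtension {n Γ m} (L : Layout n Γ m) (X : Team m) (X' : Team (suc m)) : Set where
    field
      restrict : ∀ a r → X' (a ∷ r) → X r
      spread   : ∀ a r r' → X' (a ∷ r) → X r' → SameKeys L r r' → X' (a ∷ r')

  open KeyExtension

  module _ {n n' Γ m} (L : Layout n Γ m) (varKey' : Fin n' → Fin (suc (#keys L)))
           {X : Team m} {X' : Team (suc m)} (ext : KeyExtension L X X') where
    good-addKey : Good L X → Good (addKey L varKey') X'
    good-addKey good .total (a ∷ r) x' i ā with total good r (restrict ext a r x') i ā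
    ... | r' , xr' , sameKeys e , reads =
      (a ∷ r') , spread ext a r r' x' xr' (sameKeys e) , sameKeys (λ { zero → refl ; (suc j) → e j }) , reads
    good-addKey good .functional (a ∷ r) (b ∷ r') x x' (sameKeys e) =
      functional good r r' (restrict ext a r x) (restrict ext b r' x') (sameKeys (e ∘ suc))

    envOf-addKey : ∀ a r → X' (a ∷ r) → envOf (addKey L varKey') X' (a ∷ r) ≋[ Γ ] envOf L X r
    envOf-addKey a r x = mk≋ λ i ā → mk⇔
      (λ h r' xr' (sameKeys e) →
        h (a ∷ r') (spread ext a r r' x xr' (sameKeys e)) (sameKeys λ { zero → refl ; (suc j) → e j }))
      (λ { h (b ∷ r') x' (sameKeys e) → h r' (restrict ext b r' x') (sameKeys (e ∘ suc)) })

  KeyRespecting : ∀ {n Γ m} → Layout n Γ m → Team m → (Assignment m → Dom) → Set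
  KeyRespecting L X F = ∀ r r' → X r → X r' → SameKeys L r r' → F r ≡ F r'

  supplement-keyExtension : ∀ {n Γ m} (L : Layout n Γ m) {X : Team m} {F} →
                            KeyRespecting L X F → KeyExtension L X (supplement X F)
  supplement-keyExtension L {X} {F} respects = record
    { restrict = λ { a r (s , xs , e) → subst X (proj₂ (∷-injective (sym e))) xs }
    ; spread = λ { a r r' (s , xs , e) xr' same → case (∷-injective e) xs same xr' } }
    where
    case : ∀ {a r r' s} → a ≡ F s × r ≡ s → X s → SameKeys L r r' → X r' → supplement X F (a ∷ r')
    case (refl , refl) xs same xr' = _ , xr' , cong (_∷ _) (respects _ _ xs xr' same)

  dependsOnKeys-⊨ : ∀ {n Γ m} (L : Layout n Γ m) X F → supplement X F ⊨ dependsOnKeys L ⇔ KeyRespecting L X F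
  dependsOnKeys-⊨ L X F = mk⇔
    (λ h r r' xr xr' (sameKeys e) → to keyDependence h _ _ (r , xr , refl) (r' , xr' , refl) e (λ ()))
    (λ respects → from keyDependence
      λ { _ _ (r , xr , refl) (r' , xr' , refl) e _ → respects r r' xr xr' (sameKeys e) })
    where keyDependence = dependence-⊨ {k = 0} (suc ∘ key L) (λ ()) zero (supplement X F)

  duplicate-keyExtension : ∀ {n Γ m} (L : Layout n Γ m) {X : Team m} → KeyExtension L X (duplicate X)
  duplicate-keyExtension L {X} = record
    { restrict = λ { a r (s , b , xs , e) → subst X (proj₂ (∷-injective (sym e))) xs }
    ; spread = λ a r r' _ xr' _ → r' , a , xr' , refl }

  all-defines : ∀ {n Γ m} (L : Layout n Γ m) {A : IDForm V (suc m)} {P : Env Γ → Assignment (suc n) → Set₁} →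
    EnvInvariant {Γ = Γ} P → Defines (addVar L) A P → Defines L (all A) (λ ρ s → ∀ a → P ρ (a ∷ s))
  all-defines L invariant defines .at X good = mk⇔
    (λ h r xr a → invariant (envEq a r xr) _ (to defines' h (a ∷ r) (r , a , xr , refl)))
    (λ h → from defines' λ { _ (r , a , xr , refl) → invariant (≋-sym (envEq a r xr)) _ (h r xr a) })
    where
    ext = duplicate-keyExtension L
    defines' = defines .at (duplicate X) (good-addKey L _ ext good)
    envEq = λ a r xr → envOf-addKey L _ ext a r (r , a , xr , refl)

  sameKeys-transport : ∀ {n Γ m} (L : Layout n Γ m) (X : Team m) {R : Env Γ → Assignment n → Set₁} →
                 EnvInvariant {Γ = Γ} R → ∀ {r r'} → SameKeys L r r' →
                 R (envOf L X r') (assignmentOf L r') → R (envOf L X r) (assignmentOf L r)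
  sameKeys-transport L X {R} invariant same =
    invariant (envOf-cong L (sameKeys-sym same) X) _ ∘ subst (R _) (assignmentOf-cong L (sameKeys-sym same))

  keyedEx-defines : ∀ {n Γ m} (L : Layout n Γ m) {A : IDForm V (suc m)} {P : Env Γ → Assignment (suc n) → Set₁} →
    EnvInvariant {Γ = Γ} P → Defines (addVar L) A P → Defines L (keyedEx L A) (λ ρ s → Σ Dom λ a → P ρ (a ∷ s))
  keyedEx-defines {Γ = Γ} L {A} {P} invariant defines .at X good = mk⇔ witnesses chooses
    where
    module _ {F} (respects : KeyRespecting L X F) where
      ext = supplement-keyExtension L respects
      defines' = defines .at (supplement X F) (good-addKey L _ ext good)
      envEq : ∀ r (xr : X r) → envOf (addVar L) (supplement X F) (F r ∷ r) ≋[ Γ ] envOf L X r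
      envEq r xr = envOf-addKey L _ ext (F r) r (r , xr , refl)
    Witnessed : Assignment _ → Dom → Set₁
    Witnessed r a = P (envOf L X r) (a ∷ assignmentOf L r)
    witnesses : X ⊨ keyedEx L A → ∀ r → X r → Σ Dom (Witnessed r)
    witnesses (F , hdep , hA) r xr =
      F r , invariant (envEq respects r xr) _ (to (defines' respects) hA (F r ∷ r) (r , xr , refl))
      where respects = to (dependsOnKeys-⊨ L X F) hdep
    transport : ∀ r r' a → SameKeys L r r' → Witnessed r' a → Witnessed r a
    transport r r' a = sameKeys-transport L X (λ e s → invariant e (a ∷ s))
    chooses : (∀ r → X r → Σ Dom (Witnessed r)) → X ⊨ keyedEx L A
    chooses h with choiceOnKeys L X elem Witnessed transport h
    ... | F , F-respects , F-chooses = F , from (dependsOnKeys-⊨ L X F) respects ,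
          from (defines' respects) λ { _ (r , xr , refl) → invariant (≋-sym (envEq respects r xr)) _ (F-chooses r xr) }
      where
      respects : KeyRespecting L X F
      respects r r' _ _ = F-respects r r'

  vec-ext : ∀ {k} {u v : Vec Dom k} → (∀ j → lookup u j ≡ lookup v j) → u ≡ v
  vec-ext {u = u} {v} h = trans (sym (tabulate∘lookup u)) (trans (tabulate-cong h) (tabulate∘lookup v))

  -- The relation variable introduced by addRel, realised over X by the function G.
  graphTeam : ∀ {m k} → Team m → (Assignment m → Vec Dom k → Dom) → Team (suc (k + m))
  graphTeam {m} {k} X G t = Σ (Assignment m) λ r → Σ (Vec Dom k) λ v → X r × t ≡ G r v ∷ v ++ r

  module _ {n Γ m} (L : Layout n Γ m) (k : ℕ) where
    sameKeys-addRel⁻ : ∀ {y y'} (v v' : Vec Dom k) {r r'} →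
                       SameKeys (addRel k L) (y ∷ v ++ r) (y' ∷ v' ++ r') → SameKeys L r r'
    sameKeys-addRel⁻ v v' {r} {r'} (sameKeys e) =
      sameKeys λ j → trans (sym (lookup-++ʳ v r (key L j))) (trans (e j) (lookup-++ʳ v' r' (key L j)))

    sameKeys-addRel⁺ : ∀ {y y'} (v v' : Vec Dom k) {r r'} →
                       SameKeys L r r' → SameKeys (addRel k L) (y ∷ v ++ r) (y' ∷ v' ++ r')
    sameKeys-addRel⁺ v v' {r} {r'} (sameKeys e) =
      sameKeys λ j → trans (lookup-++ʳ v r (key L j)) (trans (e j) (sym (lookup-++ʳ v' r' (key L j))))

    assignmentOf-addRel : ∀ y (v : Vec Dom k) r → assignmentOf (addRel k L) (y ∷ v ++ r) ≡ assignmentOf L r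
    assignmentOf-addRel y v r = tabulate-cong (lookup-++ʳ v r ∘ varCol L)

    readsArgs : ∀ (v : Vec Dom k) r → ReadsAt (v ++ r) (_↑ˡ m) v
    readsArgs = lookup-++ˡ

    readsArgs-unique : ∀ (v : Vec Dom k) r {ā} → ReadsAt (v ++ r) (_↑ˡ m) ā → v ≡ ā
    readsArgs-unique v r reads = vec-ext λ j → trans (sym (readsArgs v r j)) (reads j)

    agreeOnArgs : ∀ (v v' : Vec Dom k) r r' → AgreeOn (_↑ˡ m) (v ++ r) (v' ++ r') → v ≡ v'
    agreeOnArgs v v' r r' agree = readsArgs-unique v r λ j → trans (agree j) (readsArgs v' r' j)

    module _ {X : Team m} {G : Assignment m → Vec Dom k → Dom}
             (respects : ∀ v → KeyRespecting L X (λ r → G r v)) where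
      good-graphTeam : Good L X → Good (addRel k L) (graphTeam X G)
      good-graphTeam good .total _ (r , v , xr , refl) zero ā =
        (G r ā ∷ ā ++ r) , (r , ā , xr , refl) , sameKeys-addRel⁺ v ā sameKeys-refl , readsArgs ā r
      good-graphTeam good .total _ (r , v , xr , refl) (suc i) ā with total good r xr i ā
      ... | r' , xr' , same , reads =
        (G r' v ∷ v ++ r') , (r' , v , xr' , refl) , sameKeys-addRel⁺ v v same ,
        λ j → trans (lookup-++ʳ v r' (argCol L i j)) (reads j)
      good-graphTeam good .functional _ _ (r , v , xr , refl) (r' , v' , xr' , refl) same zero agree =
        trans (respects v r r' xr xr' (sameKeys-addRel⁻ v v' same)) (cong (G r') (agreeOnArgs v v' r r' agree))
      good-graphTeam good .functional _ _ (r , v , xr , refl) (r' , v' , xr' , refl) same (suc i) agree =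
        trans (lookup-++ʳ v r (valCol L i))
          (trans (functional good r r' xr xr' (sameKeys-addRel⁻ v v' same) i
                   (λ j → trans (sym (lookup-++ʳ v r (argCol L i j))) (trans (agree j) (lookup-++ʳ v' r' (argCol L i j)))))
                 (sym (lookup-++ʳ v' r' (valCol L i))))

      envOf-graphTeam : ∀ r v → X r →
        envOf (addRel k L) (graphTeam X G) (G r v ∷ v ++ r)
          ≋[ k ∷ Γ ] extend {Γ = Γ} (λ ā → G r ā ≡ constOf L r) (envOf L X r)
      envOf-graphTeam r v xr = mk≋ λ
        { zero ā → mk⇔
            (λ h → trans (h _ (r , ā , xr , refl) (sameKeys-addRel⁺ v ā sameKeys-refl) (readsArgs ā r))
                         (lookup-++ʳ ā r (constCol L)))
            (λ { e _ (r' , v' , xr' , refl) same reads →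
                 valueOf e xr' (sameKeys-addRel⁻ v v' same) (readsArgs-unique v' r' reads) })
        ; (suc i) ā → mk⇔
            (λ h r' xr' same reads → trans (sym (lookup-++ʳ v r' (valCol L i)))
              (trans (h _ (r' , v , xr' , refl) (sameKeys-addRel⁺ v v same)
                        (λ j → trans (lookup-++ʳ v r' (argCol L i j)) (reads j)))
                     (lookup-++ʳ v r' (constCol L))))
            (λ { h _ (r' , v' , xr' , refl) same reads → trans (lookup-++ʳ v' r' (valCol L i))
              (trans (h r' xr' (sameKeys-addRel⁻ v v' same)
                        (λ j → trans (sym (lookup-++ʳ v' r' (argCol L i j))) (reads j)))
                     (sym (lookup-++ʳ v' r' (constCol L)))) }) }
        where
        valueOf : ∀ {ā v' r'} → G r ā ≡ constOf L r → X r' → SameKeys L r r' → v' ≡ ā →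
                  G r' v' ≡ lookup (v' ++ r') (k ↑ʳ constCol L)
        valueOf {ā} {v'} {r'} e xr' same refl = begin
          G r' ā                        ≡⟨ respects ā r r' xr xr' same ⟨
          G r ā                         ≡⟨ e ⟩
          constOf L r                   ≡⟨ constOf-cong L same ⟩
          constOf L r'                  ≡⟨ lookup-++ʳ ā r' (constCol L) ⟨
          lookup (ā ++ r') (k ↑ʳ constCol L) ∎
          where open ≡-Reasoning

      graphTeam-⊨-dependsOnKeysAndArgs : graphTeam X G ⊨ dependsOnKeysAndArgs k L
      graphTeam-⊨-dependsOnKeysAndArgs = from (dependence-⊨ _ _ zero (graphTeam X G))
        λ { _ _ (r , v , xr , refl) (r' , v' , xr' , refl) agreeKeys agreeArgs →
            trans (respects v r r' xr xr' (sameKeys-addRel⁻ {G r v} {G r' v'} v v' (sameKeys agreeKeys)))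
                  (cong (G r') (agreeOnArgs v v' r r' agreeArgs)) }

      graphTeam-defines : Good L X → ∀ {A P} → EnvInvariant {Γ = k ∷ Γ} P → Defines (addRel k L) A P →
        graphTeam X G ⊨ A ⇔
        (∀ r → X r → P (extend {Γ = Γ} (λ ā → G r ā ≡ constOf L r) (envOf L X r)) (assignmentOf L r))
      graphTeam-defines good {A} {P} invariant defines = mk⇔
        (λ h r xr → invariant (envOf-graphTeam r v₀ xr) _
                      (subst (P _) (assignmentOf-addRel (G r v₀) v₀ r) (to defines' h _ (r , v₀ , xr , refl))))
        (λ h → from defines' λ { _ (r , v , xr , refl) →
                 subst (P _) (sym (assignmentOf-addRel (G r v) v r))
                   (invariant (≋-sym (envOf-graphTeam r v xr)) _ (h r xr)) })
        where
        defines' = defines .at (graphTeam X G) (good-graphTeam good)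
        v₀ = replicate k elem

    graphOf : ∀ {X : Team m} (Y : Team (suc (k + m))) →
      Y ⊆ duplicate (duplicateᴺ k X) → Y ⊨ dependsOnKeysAndArgs k L →
      Σ (Assignment m → Vec Dom k → Dom) λ G → (∀ v → KeyRespecting L X (λ r → G r v)) × Y ⊆ graphTeam X G
    graphOf {X} Y Y⊆ hdep = G , respects , Y⊆graph
      where
      Value : Vec Dom (#keys L) → Vec Dom k → Set
      Value κ v = Σ Dom λ y → Σ (Assignment m) λ r → Y (y ∷ v ++ r) × keysOf L r ≡ κ
      pick : ∀ {κ v} → Dec (Value κ v) → Dom
      pick (yes (y , _)) = y
      pick (no _) = elem
      G : Assignment m → Vec Dom k → Dom
      G r v = pick (decide (Value (keysOf L r) v))
      respects : ∀ v → KeyRespecting L X (λ r → G r v)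
      respects v r r' _ _ (sameKeys e) = cong (λ κ → pick (decide (Value κ v))) (tabulate-cong e)
      G-value : ∀ y v r → Y (y ∷ v ++ r) → y ≡ G r v
      G-value y v r yt with decide (Value (keysOf L r) v)
      ... | yes (y' , r' , yt' , e) = to (dependence-⊨ _ _ zero Y) hdep _ _ yt yt'
              (agreeOnKeys (sameKeys-addRel⁺ {y} {y'} v v (keysOf-injective L (sym e))))
              (λ j → trans (readsArgs v r j) (sym (readsArgs v r' j)))
      ... | no ¬value = ⊥-elim (¬value (y , r , yt , refl))
      inGraph : ∀ t → Y t → duplicate (duplicateᴺ k X) t → graphTeam X G t
      inGraph _ yt (_ , y , (v , r , xr , refl) , refl) = r , v , xr , cong (_∷ v ++ r) (G-value y v r yt)
      Y⊆graph : Y ⊆ graphTeam X G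
      Y⊆graph t yt = inGraph t yt (Y⊆ t yt)

  argsMatch-flat : ∀ {n Γ m} (L : Layout n Γ m) i ts →
    Flat (argsMatch L i ts) (λ r → ReadsAt r (argCol L i) (evalVec ts (assignmentOf L r)))
  argsMatch-flat L i ts = Flat-cong {φ = argsMatch L i ts}
    (λ r → mk⇔ (λ h j → trans (h j) (argValue r j)) (λ h j → trans (h j) (sym (argValue r j))))
    (⋀ᴵ-flat _ {φ = λ j → atom (argEq j)} (atom-flat ∘ argEq))
    where
    argEq : ∀ j → Atom V _
    argEq j = eq (var (argCol L i j)) (rename (varCol L) (lookup ts j))
    argValue : ∀ r j → eval (rename (varCol L) (lookup ts j)) r ≡ lookup (evalVec ts (assignmentOf L r)) j
    argValue r j = trans (eval-rename (varCol L) (lookup ts j) r) (sym (lookup-evalVec ts (assignmentOf L r) j))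

  atom-renamed : ∀ {n Γ m} (L : Layout n Γ m) (a : Atom V n) r →
                 holds (renameAtom (varCol L) a) r ⇔ Lift (lsuc 0ℓ) (holds a (assignmentOf L r))
  atom-renamed L a r = mk⇔ (lift ∘ to (holds-rename (varCol L) a r)) (from (holds-rename (varCol L) a r) ∘ lower)

  module _ {n Γ m} (L : Layout n Γ m) (i : Fin (length Γ)) (ts : Vec (Term V n) (List.lookup Γ i)) where
    private
      valIsConst : Flat (valCol L i ≐ constCol L) (λ r → lookup r (valCol L i) ≡ constOf L r)
      valIsConst = atom-flat (eq (var (valCol L i)) (var (constCol L)))

      readsAt-cong : ∀ {r r'} → SameKeys L r r' → ReadsAt r' (argCol L i) (evalVec ts (assignmentOf L r)) →
                     ReadsAt r' (argCol L i) (evalVec ts (assignmentOf L r'))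
      readsAt-cong same reads j = trans (reads j) (cong (λ s → lookup (evalVec ts s) j) (assignmentOf-cong L same))

    relVar-defines : Defines L (argsMatch L i ts ⇒ (valCol L i ≐ constCol L)) (SOSat {Γ = Γ} (rvar i ts))
    relVar-defines .at X good = mk⇔
      (λ h r xr → lift λ r' xr' same reads → to (flat X) h r' xr' (readsAt-cong same reads))
      (λ h → from (flat X) λ r xr reads → lower (h r xr) r xr sameKeys-refl reads)
      where
      flat = ⇒-flat {A = argsMatch L i ts} {B = valCol L i ≐ constCol L} (argsMatch-flat L i ts) valIsConst

    negRelVar-defines : Defines L (argsMatch L i ts ⇒ ¬ᴵ (valCol L i ≐ constCol L))
                                  (λ ρ s → ¬ SOSat {Γ = Γ} (rvar i ts) ρ s)
    negRelVar-defines .at X good = mk⇔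
      (λ h r xr (lift holds) →
        let (r' , xr' , same , reads) = total good r xr i (evalVec ts (assignmentOf L r)) in
        to (flat X) h r' xr' (readsAt-cong same reads) (holds r' xr' same reads))
      (λ h → from (flat X) λ r xr reads e → h r xr (lift λ r' xr' same reads' →
        trans (sym (functional good r r' xr xr' same i (λ j → trans (reads j) (sym (reads' j)))))
              (trans e (constOf-cong L same))))
      where
      flat = ⇒-flat {A = argsMatch L i ts} {B = ¬ᴵ (valCol L i ≐ constCol L)}
               (argsMatch-flat L i ts) (¬ᴵ-flat {A = valCol L i ≐ constCol L} valIsConst)

  Selection : ∀ {n Γ m} → Layout n Γ m → Team m → (Assignment m → Dom) → (Dom → Dom → Set) →
              Team (suc m)
  Selection L X F C t = supplement X F t × C (lookup t zero) (lookup t (suc (constCol L)))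

  selection-defines : ∀ {n Γ m} (L : Layout n Γ m) {X F} → Good L X → KeyRespecting L X F → ∀ C D {R} →
    EnvInvariant {Γ = Γ} R → Defines (addSelector L) D R →
    Selection L X F C ⊨ D ⇔ (∀ r → X r → C (F r) (constOf L r) → R (envOf L X r) (assignmentOf L r))
  selection-defines L {X} {F} good respects C D invariant defines = mk⇔
    (λ h r xr c → invariant (envEq r xr c) _ (to defines' h (F r ∷ r) ((r , xr , refl) , c)))
    (λ h → from defines' λ { _ ((r , xr , refl) , c) → invariant (≋-sym (envEq r xr c)) _ (h r xr c) })
    where
    ext = supplement-keyExtension L respects
    selection-ext : KeyExtension L X (Selection L X F C)
    selection-ext = record
      { restrict = λ a r (sup , _) → restrict ext a r sup
      ; spread = λ a r r' (sup , c) xr' same →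
          spread ext a r r' sup xr' same , subst (C a) (constOf-cong L same) c }
    defines' = defines .at (Selection L X F C) (good-addKey L _ selection-ext good)
    envEq = λ r xr c → envOf-addKey L _ selection-ext (F r) r ((r , xr , refl) , c)

  module _ (distinct : Dom → Dom) (distinct-≢ : ∀ a → distinct a ≢ a) where
    keyedOr-defines : ∀ {n Γ m} (L : Layout n Γ m) {A B : IDForm V (suc m)} {P Q : Env Γ → Assignment n → Set₁} →
      EnvInvariant {Γ = Γ} P → EnvInvariant {Γ = Γ} Q →
      Defines (addSelector L) A P → Defines (addSelector L) B Q →
      Defines L (keyedOr L A B) (λ ρ s → P ρ s ⊎ Q ρ s)
    keyedOr-defines {Γ = Γ} {m} L {A} {B} {P} {Q} invP invQ definesA definesB .at X good = mk⇔ split combine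
      where
      P⟨_⟩ Q⟨_⟩ : Assignment m → Set₁
      P⟨ r ⟩ = P (envOf L X r) (assignmentOf L r)
      Q⟨ r ⟩ = Q (envOf L X r) (assignmentOf L r)

      selectorIsConst : Flat (zero ≐ suc (constCol L)) (λ t → lookup t zero ≡ lookup t (suc (constCol L)))
      selectorIsConst = atom-flat (eq (var zero) (var (suc (constCol L))))

      selectorIsNotConst : Flat (¬ᴵ (zero ≐ suc (constCol L))) (λ t → lookup t zero ≢ lookup t (suc (constCol L)))
      selectorIsNotConst = ¬ᴵ-flat {A = zero ≐ suc (constCol L)} selectorIsConst

      module _ {F} (respects : KeyRespecting L X F) where
        onSelectedA = selection-defines L good respects _≡_ A invP definesA
        onSelectedB = selection-defines L good respects _≢_ B invQ definesB

      split : X ⊨ keyedOr L A B → ∀ r → X r → P⟨ r ⟩ ⊎ Q⟨ r ⟩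
      split (F , hdep , hA , hB) r xr with decide (F r ≡ constOf L r)
      ... | yes e = inj₁ (to (onSelectedA respects) (hA _ (λ _ → proj₁) (lift λ _ → proj₂)) r xr e)
        where respects = to (dependsOnKeys-⊨ L X F) hdep
      ... | no ne =
        inj₂ (to (onSelectedB respects) (hB _ (λ _ → proj₁) (from (selectorIsNotConst _) λ _ → proj₂)) r xr ne)
        where respects = to (dependsOnKeys-⊨ L X F) hdep

      Branch : Assignment m → Dom → Set₁
      Branch r z = (z ≡ constOf L r → P⟨ r ⟩) × (z ≢ constOf L r → Q⟨ r ⟩)

      branch : (∀ r → X r → P⟨ r ⟩ ⊎ Q⟨ r ⟩) → ∀ r → X r → Σ Dom (Branch r)
      branch h r xr with em {P⟨ r ⟩} | h r xr
      ... | yes p | _ = constOf L r , (λ _ → p) , (λ ne → ⊥-elim (ne refl))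
      ... | no ¬p | inj₁ p = ⊥-elim (¬p p)
      ... | no ¬p | inj₂ q = distinct (constOf L r) , (λ e → ⊥-elim (distinct-≢ _ e)) , (λ _ → q)

      transport : ∀ r r' z → SameKeys L r r' → Branch r' z → Branch r z
      transport r r' z same (p , q) =
        (λ e → sameKeys-transport L X invP same (p (trans e (constOf-cong L same))))
        , (λ ne → sameKeys-transport L X invQ same (q (λ e → ne (trans e (sym (constOf-cong L same))))))

      combine : (∀ r → X r → P⟨ r ⟩ ⊎ Q⟨ r ⟩) → X ⊨ keyedOr L A B
      combine h with choiceOnKeys L X elem Branch transport (branch h)
      ... | F , F-respects , F-chooses = F , from (dependsOnKeys-⊨ L X F) respects ,
            (λ Y Y⊆ hEq → ⊨-downward A (λ t yt → Y⊆ t yt , lower hEq t yt)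
                            (from (onSelectedA respects) λ r xr → proj₁ (F-chooses r xr)))
          , (λ Y Y⊆ hNe → ⊨-downward B (λ t yt → Y⊆ t yt , to (selectorIsNotConst Y) hNe t yt)
                            (from (onSelectedB respects) λ r xr → proj₂ (F-chooses r xr)))
        where
        respects : KeyRespecting L X F
        respects r r' _ _ = F-respects r r'

    encode : ∀ {Q : Set} → Dec Q → Dom → Dom
    encode (yes _) c = c
    encode (no _) c = distinct c

    encode-≡ : ∀ {Q : Set} (d : Dec Q) c → encode d c ≡ c ⇔ Q
    encode-≡ (yes q) c = mk⇔ (λ _ → q) (λ _ → refl)
    encode-≡ (no ¬q) c = mk⇔ (⊥-elim ∘ distinct-≢ c) (⊥-elim ∘ ¬q)

    codeOf : ∀ {k} → (Vec Dom k → Set) → Dom → Vec Dom k → Dom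
    codeOf R c ā = encode (decide (R ā)) c

    codeOf-≡ : ∀ {k} (R : Vec Dom k → Set) c ā → codeOf R c ā ≡ c ⇔ R ā
    codeOf-≡ R c ā = encode-≡ (decide (R ā)) c

    module _ {n Γ m} (L : Layout n Γ m) k {A : IDForm V (suc (k + m))} {P : Env (k ∷ Γ) → Assignment n → Set₁}
             (invariant : EnvInvariant {Γ = k ∷ Γ} P) (defines : Defines (addRel k L) A P) {X : Team m} (good : Good L X) where
      private
        P⟨_,_⟩ : Assignment m → (Vec Dom k → Set) → Set₁
        P⟨ r , R ⟩ = P (extend {Γ = Γ} R (envOf L X r)) (assignmentOf L r)

        onGraph : ∀ {G} → (∀ v → KeyRespecting L X (λ r → G r v)) →
                  graphTeam X G ⊨ A ⇔ (∀ r → X r → P⟨ r , (λ ā → G r ā ≡ constOf L r) ⟩)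
        onGraph respects = graphTeam-defines L k respects good invariant defines

      relAll-⊨ : X ⊨ relAll k L A ⇔ (∀ r → X r → ∀ R → P⟨ r , R ⟩)
      relAll-⊨ = mk⇔ instantiate generalize
        where
        instantiate : X ⊨ relAll k L A → ∀ r → X r → ∀ R → P⟨ r , R ⟩
        instantiate h r xr R =
          invariant (extend-cong {Γ = Γ} (codeOf-≡ R (constOf L r)) ≋-refl) _ (to (onGraph respects) hG r xr)
          where
          G : Assignment m → Vec Dom k → Dom
          G r' = codeOf R (constOf L r')
          respects : ∀ v → KeyRespecting L X (λ r' → G r' v)
          respects v r₁ r₂ _ _ same = cong (λ c → codeOf R c v) (constOf-cong L same)
          hG : graphTeam X G ⊨ A
          hG = to (∀ᴺ-⊨ k _ X) h (graphTeam X G)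
                 (λ { _ (r' , v , xr' , refl) → (v ++ r') , G r' v , (v , r' , xr' , refl) , refl })
                 (graphTeam-⊨-dependsOnKeysAndArgs L k respects)

        generalize : (∀ r → X r → ∀ R → P⟨ r , R ⟩) → X ⊨ relAll k L A
        generalize h = from (∀ᴺ-⊨ k _ X) λ Y Y⊆ hdep →
          let (G , respects , Y⊆graph) = graphOf L k Y Y⊆ hdep in
          ⊨-downward A Y⊆graph (from (onGraph respects) λ r xr → h r xr _)

      relEx-⊨ : X ⊨ relEx k L A ⇔ (∀ r → X r → Σ (Vec Dom k → Set) λ R → P⟨ r , R ⟩)
      relEx-⊨ = mk⇔ witness choose
        where
        witness : X ⊨ relEx k L A → ∀ r → X r → Σ (Vec Dom k → Set) λ R → P⟨ r , R ⟩
        witness h r xr = let (F , hdep , hA) = to (∀ᴺ-⊨ k _ X) h in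
          (λ ā → F (ā ++ r) ≡ constOf L r) , to (onGraph (respects F hdep)) (⊨-downward A (graph⊆ F) hA) r xr
          where
          graph⊆ : ∀ F → graphTeam X (λ r' v → F (v ++ r')) ⊆ supplement (duplicateᴺ k X) F
          graph⊆ F _ (r' , v , xr' , refl) = (v ++ r') , (v , r' , xr' , refl) , refl
          respects : ∀ F → supplement (duplicateᴺ k X) F ⊨ dependsOnKeysAndArgs k L →
                     ∀ v → KeyRespecting L X (λ r' → F (v ++ r'))
          respects F hdep v r₁ r₂ x₁ x₂ same =
            to (dependence-⊨ _ _ zero _) hdep _ _ (graph⊆ F _ (r₁ , v , x₁ , refl)) (graph⊆ F _ (r₂ , v , x₂ , refl))
              (agreeOnKeys (sameKeys-addRel⁺ L k {F (v ++ r₁)} {F (v ++ r₂)} v v same))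
              (λ j → trans (readsArgs L k v r₁ j) (sym (readsArgs L k v r₂ j)))

        Coded : Assignment m → (Vec Dom k → Dom) → Set₁
        Coded r g = P⟨ r , (λ ā → g ā ≡ constOf L r) ⟩

        transport : ∀ r r' g → SameKeys L r r' → Coded r' g → Coded r g
        transport r r' g same =
          sameKeys-transport L X (λ e → invariant (extend-cong {Γ = Γ} (λ _ → ⇔-id _) e)) same
          ∘ subst (λ c → P (extend {Γ = Γ} (λ ā → g ā ≡ c) _) _) (sym (constOf-cong L same))

        coding : (∀ r → X r → Σ (Vec Dom k → Set) λ R → P⟨ r , R ⟩) → ∀ r → X r → Σ (Vec Dom k → Dom) (Coded r)
        coding h r xr = let (R , p) = h r xr in
          codeOf R (constOf L r) , invariant (extend-cong {Γ = Γ} (⇔-sym ∘ codeOf-≡ R (constOf L r)) ≋-refl) _ p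

        choose : (∀ r → X r → Σ (Vec Dom k → Set) λ R → P⟨ r , R ⟩) → X ⊨ relEx k L A
        choose h with choiceOnKeys L X (λ _ → elem) Coded transport (coding h)
        ... | G , G-respects , G-coded = from (∀ᴺ-⊨ k _ X)
              (F , ⊨-downward (dependsOnKeysAndArgs k L ∧ A) supplement⊆graph
                     (graphTeam-⊨-dependsOnKeysAndArgs L k respects , from (onGraph respects) G-coded))
          where
          F : Assignment (k + m) → Dom
          F s = G (drop k s) (take k s)
          respects : ∀ v → KeyRespecting L X (λ r → G r v)
          respects v r r' _ _ same = cong (λ g → g v) (G-respects r r' same)
          supplement⊆graph : supplement (duplicateᴺ k X) F ⊆ graphTeam X G
          supplement⊆graph _ (_ , (v , r , xr , refl) , refl) =
            r , v , xr , cong (_∷ v ++ r) (cong₂ G (proj₂ (take-drop-++ v r)) (proj₁ (take-drop-++ v r)))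

    relAll-defines : ∀ {n Γ m} (L : Layout n Γ m) k {A : IDForm V (suc (k + m))} {P : Env (k ∷ Γ) → Assignment n → Set₁} →
      EnvInvariant {Γ = k ∷ Γ} P → Defines (addRel k L) A P →
      Defines L (relAll k L A) (λ ρ s → ∀ R → P (extend {Γ = Γ} R ρ) s)
    relAll-defines L k invariant defines .at X good = relAll-⊨ L k invariant defines good

    relEx-defines : ∀ {n Γ m} (L : Layout n Γ m) k {A : IDForm V (suc (k + m))} {P : Env (k ∷ Γ) → Assignment n → Set₁} →
      EnvInvariant {Γ = k ∷ Γ} P → Defines (addRel k L) A P →
      Defines L (relEx k L A) (λ ρ s → Σ (Vec Dom k → Set) λ R → P (extend {Γ = Γ} R ρ) s)
    relEx-defines L k invariant defines .at X good = relEx-⊨ L k invariant defines good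

    translate-defines : ∀ {n Γ m} b (φ : SOForm V n Γ) (L : Layout n Γ m) →
                        Defines L (translate b φ L) (SOSatᵇ b φ)
    translate-defines true (atom a) L = flat-defines (atom-flat (renameAtom (varCol L) a)) (atom-renamed L a)
    translate-defines false (atom a) L =
      flat-defines (¬ᴵ-flat {A = atom (renameAtom (varCol L) a)} (atom-flat (renameAtom (varCol L) a)))
                   (¬-cong-⇔ ∘ atom-renamed L a)
    translate-defines true (rvar i ts) L = relVar-defines L i ts
    translate-defines false (rvar i ts) L = negRelVar-defines L i ts
    translate-defines true (neg φ) L = translate-defines false φ L
    translate-defines false (neg φ) L = Defines-cong (λ _ _ → ⇔-sym ¬¬-⇔) (translate-defines true φ L)
    translate-defines true (φ ∧ ψ) L = ∧-defines (translate-defines true φ L) (translate-defines true ψ L)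
    translate-defines false (φ ∧ ψ) L = Defines-cong (λ _ _ → ⇔-sym ¬×-⇔)
      (keyedOr-defines L (SOSatᵇ-invariant false φ) (SOSatᵇ-invariant false ψ)
                         (translate-defines false φ (addSelector L)) (translate-defines false ψ (addSelector L)))
    translate-defines true (φ ∨ ψ) L =
      keyedOr-defines L (SOSatᵇ-invariant true φ) (SOSatᵇ-invariant true ψ)
                        (translate-defines true φ (addSelector L)) (translate-defines true ψ (addSelector L))
    translate-defines false (φ ∨ ψ) L = Defines-cong (λ _ _ → ⇔-sym ¬⊎-⇔)
      (∧-defines (translate-defines false φ L) (translate-defines false ψ L))
    translate-defines true (all1 φ) L = all-defines L (SOSatᵇ-invariant true φ) (translate-defines true φ (addVar L))
    translate-defines false (all1 φ) L = Defines-cong (λ _ _ → ⇔-sym (¬Π-⇔ dne))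
      (keyedEx-defines L (SOSatᵇ-invariant false φ) (translate-defines false φ (addVar L)))
    translate-defines true (ex1 φ) L = keyedEx-defines L (SOSatᵇ-invariant true φ) (translate-defines true φ (addVar L))
    translate-defines false (ex1 φ) L = Defines-cong (λ _ _ → ⇔-sym ¬Σ-⇔)
      (all-defines L (SOSatᵇ-invariant false φ) (translate-defines false φ (addVar L)))
    translate-defines true (all2 k φ) L =
      relAll-defines L k (SOSatᵇ-invariant true φ) (translate-defines true φ (addRel k L))
    translate-defines false (all2 k φ) L = Defines-cong (λ _ _ → ⇔-sym (¬Π-⇔ dne))
      (relEx-defines L k (SOSatᵇ-invariant false φ) (translate-defines false φ (addRel k L)))
    translate-defines true (ex2 k φ) L =
      relEx-defines L k (SOSatᵇ-invariant true φ) (translate-defines true φ (addRel k L))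
    translate-defines false (ex2 k φ) L = Defines-cong (λ _ _ → ⇔-sym ¬Σ-⇔)
      (relAll-defines L k (SOSatᵇ-invariant false φ) (translate-defines false φ (addRel k L)))

module SingletonDomain (V : Vocabulary) (M : Structure V) (em : ExcludedMiddle (lsuc 0ℓ))
                       (trivial : ∀ (a b : Structure.Dom M) → a ≡ b) where
  open Structure M
  open Semantics V M
  open Syntax V
  open TeamSemantics V M
  open Classical em

  vec-trivial : ∀ {n} (u v : Vec Dom n) → u ≡ v
  vec-trivial [] [] = refl
  vec-trivial (a ∷ u) (b ∷ v) = cong₂ _∷_ (trivial a b) (vec-trivial u v)

  TruthValues : ∀ {Γ} → (Fin (length Γ) → Bool) → Env Γ → Set
  TruthValues β ρ = ∀ i v → ρ i v ⇔ β i ≡ true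

  constRel : ∀ {k} → Bool → Vec Dom k → Set
  constRel b _ = b ≡ true

  relation-truthValue : ∀ {k} (R : Vec Dom k → Set) → Σ Bool λ b → ∀ v → R v ⇔ b ≡ true
  relation-truthValue {k} R with decide (R (replicate k elem))
  ... | yes r = true , λ v → mk⇔ (λ _ → refl) (λ _ → subst R (vec-trivial _ v) r)
  ... | no ¬r = false , λ v → mk⇔ (λ rv → ⊥-elim (¬r (subst R (vec-trivial v _) rv))) (λ ())

  truthValues-extend : ∀ {Γ k} {β : Fin (length Γ) → Bool} {ρ : Env Γ} {b} {R : Vec Dom k → Set} →
    TruthValues {Γ} β ρ → (∀ v → R v ⇔ b ≡ true) → TruthValues {k ∷ Γ} (b Vector.∷ β) (extend {Γ = Γ} R ρ)
  truthValues-extend tv R⇔b zero = R⇔b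
  truthValues-extend tv R⇔b (suc i) = tv i

  truthValue-⊨ : ∀ {n} b {P : Set} {X : Team n} {s} → X s → (P ⇔ b ≡ true) →
                 X ⊨ truthValue b ⇔ Lift (lsuc 0ℓ) P
  truthValue-⊨ true xs P⇔b = mk⇔ (λ _ → lift (from P⇔b refl)) (λ _ → ⊨⊤ᴵ)
  truthValue-⊨ false xs P⇔b = mk⇔ (λ h → ⊥-elim (lower h _ xs)) (λ (lift p) → ⊥-elim (false≢true (to P⇔b p)))
    where
    false≢true : false ≢ true
    false≢true ()

  -- Over a one-element domain every nonempty team is the team {s}.
  translate₁-⊨ : ∀ {n Γ} (β : Fin (length Γ) → Bool) (φ : SOForm V n Γ) {ρ : Env Γ} →
                 TruthValues {Γ} β ρ → ∀ {X s} → X s → X ⊨ translate₁ β φ ⇔ SOSat φ ρ s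
  translate₁-⊨ β (atom a) tv {s = s} xs =
    mk⇔ (λ h → lift (lower h s xs)) (λ p → lift λ s' _ → subst (holds a) (vec-trivial s s') (lower p))
  translate₁-⊨ β (rvar i ts) tv xs = truthValue-⊨ (β i) xs (tv i _)
  translate₁-⊨ β (neg φ) {ρ} tv {X} {s} xs = mk⇔
    (λ h p → lower (h X (λ _ x → x) (from (translate₁-⊨ β φ tv xs) p)) s xs)
    (λ ¬p Y _ hY → lift λ s' ys' →
      ¬p (subst (SOSat φ ρ) (vec-trivial s' s) (to (translate₁-⊨ β φ tv ys') hY)))
  translate₁-⊨ β (φ ∧ ψ) tv xs = translate₁-⊨ β φ tv xs ×-⇔ translate₁-⊨ β ψ tv xs
  translate₁-⊨ β (φ ∨ ψ) tv xs = translate₁-⊨ β φ tv xs ⊎-⇔ translate₁-⊨ β ψ tv xs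
  translate₁-⊨ β (all1 φ) tv {s = s} xs = mk⇔
    (λ h a → to (translate₁-⊨ β φ tv (s , a , xs , refl)) h)
    (λ h → from (translate₁-⊨ β φ tv (s , elem , xs , refl)) (h elem))
  translate₁-⊨ β (ex1 φ) tv {s = s} xs = mk⇔
    (λ (F , h) → F s , to (translate₁-⊨ β φ tv (s , xs , refl)) h)
    (λ (a , p) → (λ _ → a) , from (translate₁-⊨ β φ tv (s , xs , refl)) p)
  translate₁-⊨ {Γ = Γ} β (all2 k φ) {ρ} tv {X} {s} xs = mk⇔
    (λ (h₁ , h₂) R → let (b , R⇔b) = relation-truthValue R in to (extended b R⇔b) (select {Holds} b h₁ h₂))
    (λ h → from (extended true λ _ → ⇔-id _) (h (constRel true))
         , from (extended false λ _ → ⇔-id _) (h (constRel false)))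
    where
    Holds : Bool → Set₁
    Holds b = X ⊨ translate₁ (b Vector.∷ β) φ
    extended : ∀ b {R : Vec Dom k → Set} → (∀ v → R v ⇔ b ≡ true) → Holds b ⇔ SOSat φ (extend {Γ = Γ} R ρ) s
    extended b R⇔b = translate₁-⊨ (b Vector.∷ β) φ (truthValues-extend {Γ = Γ} tv R⇔b) xs
    select : ∀ {A : Bool → Set₁} b → A true → A false → A b
    select true a _ = a
    select false _ a = a
  translate₁-⊨ {Γ = Γ} β (ex2 k φ) {ρ} tv {X} {s} xs = mk⇔
    (λ { (inj₁ h) → constRel true , to (extended true λ _ → ⇔-id _) h
       ; (inj₂ h) → constRel false , to (extended false λ _ → ⇔-id _) h })
    (λ (R , p) → let (b , R⇔b) = relation-truthValue R in inject {Holds} b (from (extended b R⇔b) p))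
    where
    Holds : Bool → Set₁
    Holds b = X ⊨ translate₁ (b Vector.∷ β) φ
    extended : ∀ b {R : Vec Dom k → Set} → (∀ v → R v ⇔ b ≡ true) → Holds b ⇔ SOSat φ (extend {Γ = Γ} R ρ) s
    extended b R⇔b = translate₁-⊨ (b Vector.∷ β) φ (truthValues-extend {Γ = Γ} tv R⇔b) xs
    inject : ∀ {A : Bool → Set₁} b → A b → A true ⊎ A false
    inject true = inj₁
    inject false = inj₂

module Correctness (em : ExcludedMiddle (lsuc 0ℓ)) (V : Vocabulary) (M : Structure V) where
  open Structure M
  open Semantics V M
  open Syntax V
  open TeamSemantics V M
  open SecondOrder V M
  open Classical em
  open Encoding V M em

  atMostOneElement-⊨ : ∀ {X : Team 0} → X [] → X ⊨ atMostOneElement ⇔ (∀ (a b : Dom) → a ≡ b)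
  atMostOneElement-⊨ x = mk⇔
    (λ h a b → lower h (a ∷ b ∷ []) ((b ∷ []) , a , ([] , b , x , refl) , refl))
    (λ trivial → lift λ _ _ → trivial _ _)

  twoElements : ¬ (∀ (a b : Dom) → a ≡ b) → Σ Dom λ a → Σ Dom λ b → a ≢ b
  twoElements nontrivial = lower (dne λ ¬two →
    nontrivial λ a b → decidable-stable (decide (a ≡ b)) λ a≢b → ¬two (lift (a , b , a≢b)))

  fixedPointFree : ¬ (∀ (a b : Dom) → a ≡ b) → Σ (Dom → Dom) λ f → ∀ a → f a ≢ a
  fixedPointFree nontrivial with twoElements nontrivial
  ... | a₀ , b₀ , a₀≢b₀ = (λ c → other (decide (c ≡ a₀))) , (λ c → other-≢ (decide (c ≡ a₀)))
    where
    other : ∀ {c} → Dec (c ≡ a₀) → Dom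
    other (yes _) = b₀
    other (no _) = a₀
    other-≢ : ∀ {c} (d : Dec (c ≡ a₀)) → other d ≢ c
    other-≢ (yes refl) = a₀≢b₀ ∘ sym
    other-≢ (no c≢a₀) = c≢a₀ ∘ sym

  translation-⊨-trivial : (∀ (a b : Dom) → a ≡ b) →
                          ∀ ψ → emptyAssignmentTeam ⊨ translation ψ ⇔ SOSat ψ emptyEnv []
  translation-⊨-trivial trivial ψ = mk⇔
    (λ { (inj₁ (_ , h)) → to translate₁-ψ h
       ; (inj₂ (¬one , _)) → ⊥-elim (lower (¬one _ (λ _ x → x) (from (atMostOneElement-⊨ tt) trivial)) [] tt) })
    (λ p → inj₁ (from (atMostOneElement-⊨ tt) trivial , from translate₁-ψ p))
    where
    translate₁-ψ = SingletonDomain.translate₁-⊨ V M em trivial (λ ()) ψ {emptyEnv} (λ ()) {emptyAssignmentTeam} tt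

  translation-⊨-nontrivial : ¬ (∀ (a b : Dom) → a ≡ b) →
                             ∀ ψ → emptyAssignmentTeam ⊨ translation ψ ⇔ SOSat ψ emptyEnv []
  translation-⊨-nontrivial nontrivial ψ = mk⇔
    (λ { (inj₁ (one , _)) → ⊥-elim (nontrivial (to (atMostOneElement-⊨ tt) one))
       ; (inj₂ (_ , F , h)) → to (SOSat-cong ψ envOf-empty []) (to (defines F) h _ ([] , tt , refl)) })
    (λ p → inj₂ (¬one , (λ _ → elem) , from (defines _) λ _ _ → from (SOSat-cong ψ envOf-empty []) p))
    where
    distinct = fixedPointFree nontrivial
    defines : ∀ F → let X = supplement emptyAssignmentTeam F in
              X ⊨ translate true ψ constantLayout ⇔ (∀ r → X r → SOSat ψ (envOf constantLayout X r) [])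
    defines F = translate-defines (proj₁ distinct) (proj₂ distinct) true ψ constantLayout .at _
                  (record { total = λ _ _ () ; functional = λ _ _ _ _ _ () })
    envOf-empty : ∀ {ρ : Env []} → ρ ≋[ [] ] emptyEnv
    envOf-empty = mk≋ λ ()
    ¬one : emptyAssignmentTeam ⊨ ¬ᴵ atMostOneElement
    ¬one Y _ hY = lift λ { [] y → nontrivial (to (atMostOneElement-⊨ y) hY) }

  translation-⊨ : ∀ ψ → emptyAssignmentTeam ⊨ translation ψ ⇔ SOSat ψ emptyEnv []
  translation-⊨ ψ with decide (∀ (a b : Dom) → a ≡ b)
  ... | yes trivial = translation-⊨-trivial trivial ψ
  ... | no nontrivial = translation-⊨-nontrivial nontrivial ψ

theorem22 : ExcludedMiddle (lsuc 0ℓ) →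
    (V : Vocabulary) (ψ : SOSentence V) →
    Σ (IDSentence V) λ φ → (M : Structure V) →
    ((_⊨SO_ V M ψ → _⊨ID_ V M φ) × (_⊨ID_ V M φ → _⊨SO_ V M ψ))
theorem22 em V ψ = Syntax.translation V ψ , λ M →
  let correct = Correctness.translation-⊨ em V M ψ in from correct , to correct
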